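{- There is no non-principal Dodd-sound ultrafilter on $\omega$.
   Context: An ultrafilter $U$ on $\omega$ is Dodd-sound if there is a sequence $\langle\mathcal{A}_n\mid n<\omega\rangle$ with $\mathcal{A}_n\subseteq\mathcal{P}(n)$ such that for every sequence $\langle X_n\mid n<\omega\rangle$ with $X_n\subseteq n$, the following are equivalent: (1) $\langle X_n\mid n<\omega\rangle$ is $U$-threadable, i.e. there is $X\subseteq\omega$ with $\{n<\omega\mid X\cap n=X_n\}\in U$; (2) $\{n<\omega\mid X_n\in\mathcal{A}_n\}\in U$. (Here $n=\{0,\dots,n-1\}$.) -}

module Defs where

open import Data.Nat using (ℕ)
open import Data.Bool using (Bool; true; false; not; _∧_; T)
import Data.Bool.Properties as BoolP
import Data.Nat.Properties as NatP
open import Data.Fin using (Fin; toℕ)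
open import Data.Fin.Subset using (Subset)
open import Data.Vec using (tabulate)
open import Data.Vec.Properties using (≡-dec)
open import Data.Product using (∃; Σ)
open import Data.Sum using (_⊎_)
open import Relation.Nullary using (¬_)
open import Relation.Nullary.Decidable using (⌊_⌋)
open import Function.Bundles using (_⇔_)

Subsetω : Set
Subsetω = ℕ → Bool

_∈ω_ : ℕ → Subsetω → Set
n ∈ω X = T (X n)

record IsUltrafilter (U : Subsetω → Set) : Set where
  field
    whole    : U (λ _ → true)
    noEmpty  : ¬ U (λ _ → false)
    upward   : ∀ X Y → (∀ n → n ∈ω X → n ∈ω Y) → U X → U Y
    inter    : ∀ X Y → U X → U Y → U (λ n → X n ∧ Y n)
    ultra    : ∀ X → U X ⊎ U (λ n → not (X n))

singleton : ℕ → Subsetω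
singleton k n = ⌊ n NatP.≟ k ⌋

-- Non-principal: no singleton belongs to U (for ultrafilters this is
-- equivalent to U not being of the form {X | k ∈ X}).
NonPrincipal : (Subsetω → Set) → Set
NonPrincipal U = ∀ k → ¬ U (singleton k)

restrict : Subsetω → (n : ℕ) → Subset n
restrict X n = tabulate (λ (i : Fin n) → X (toℕ i))

eqSub : ∀ {n} → Subset n → Subset n → Bool
eqSub A B = ⌊ ≡-dec BoolP._≟_ A B ⌋

Threadable : (Subsetω → Set) → ((n : ℕ) → Subset n) → Set
Threadable U Xs = ∃ λ (X : Subsetω) → U (λ n → eqSub (restrict X n) (Xs n))

DoddSound : (Subsetω → Set) → Set
DoddSound U =
  Σ ((n : ℕ) → Subset n → Bool) λ 𝒜 →
    ∀ (Xs : (n : ℕ) → Subset n) → Threadable U Xs ⇔ U (λ n → 𝒜 n (Xs n))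

-- Order the subsets of m+1 by putting those that contain m first and then
-- comparing lexicographically (0 before 1, smallest element first), and let
-- Xₙ be the least member of 𝒜ₙ.  Every constant sequence ⟨Z ∩ n⟩ is
-- threadable, so 𝒜ₙ is U-often nonempty and Dodd-soundness makes ⟨Xₙ⟩
-- threadable, say by X.  Since ω ∩ n ∈ 𝒜ₙ U-often, X ∩ n = Xₙ contains n-1
-- for some n, so X has an element k.  But X ∖ {k} is threadable as well, so
-- by non-principality there is an n > k+1 with X ∩ n = Xₙ and
-- (X ∖ {k}) ∩ n ∈ 𝒜ₙ; the latter set precedes the former, contradicting the
-- minimality of Xₙ.
module Submission where

open import Defs
open import Data.Bool using (Bool; true; false; not; _∧_; T; if_then_else_)
import Data.Bool as Bool
open import Data.Bool.Properties using (not-involutive; not-injective; T-∧)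
open import Data.Empty using (⊥; ⊥-elim)
open import Data.Fin.Subset using (Subset)
open import Data.Nat using (ℕ; zero; suc; _<_; _≤?_; _≟_; s≤s; z≤n)
open import Data.Nat.Properties using (≤∧≢⇒<; <⇒≢; ≤-pred)
open import Data.Product using (_,_; proj₁; proj₂)
open import Data.Sum using (inj₁; inj₂)
open import Data.Unit using (tt)
open import Data.Vec using (Vec; []; _∷_; _∷ʳ_)
open import Data.Vec.Properties using (∷ʳ-injective)
open import Data.Vec.Relation.Binary.Lex.Strict using (Lex-<; base; this; next)
open import Function using (_∘_)
open import Function.Bundles using (Equivalence)
open import Relation.Binary.PropositionalEquality
open import Relation.Nullary using (¬_; yes; no)
open import Relation.Nullary.Decidable using (⌊_⌋; toWitness; fromWitness)

_<ₗₑₓ_ : ∀ {L} → Vec Bool L → Vec Bool L → Set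
_<ₗₑₓ_ = Lex-< _≡_ Bool._<_

least : ∀ {L} → (Vec Bool L → Bool) → Vec Bool L
least {zero}  P = []
least {suc L} P =
  if P (false ∷ least (P ∘ (false ∷_)))
    then false ∷ least (P ∘ (false ∷_))
    else true ∷ least (P ∘ (true ∷_))

least-satisfies : ∀ {L} (P : Vec Bool L → Bool) v → T (P v) → T (P (least P))
least-satisfies {zero} P [] p = p
least-satisfies {suc L} P (false ∷ v) p
  with P (false ∷ least (P ∘ (false ∷_))) in eq | least-satisfies (P ∘ (false ∷_)) v p
... | true | _ = subst T (sym eq) tt
least-satisfies {suc L} P (true ∷ v) p with P (false ∷ least (P ∘ (false ∷_))) in eq
... | true  = subst T (sym eq) tt
... | false = least-satisfies (P ∘ (true ∷_)) v p

least-minimal : ∀ {L} (P : Vec Bool L → Bool) v → T (P v) → ¬ (v <ₗₑₓ least P)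
least-minimal {zero}  P [] _ (base ())
least-minimal {suc L} P (b ∷ v) p
  with P (false ∷ least (P ∘ (false ∷_))) | least-satisfies (P ∘ (false ∷_))
... | true  | _ = λ { (this () _) ; (next refl v<) → least-minimal (P ∘ (false ∷_)) v p v< }
... | false | satisfies₀ = λ
  { (this Bool.f<t _) → satisfies₀ v p
  ; (next refl v<) → least-minimal (P ∘ (true ∷_)) v p v< }

restrict-∷ʳ : ∀ (Y : Subsetω) m → restrict Y (suc m) ≡ restrict Y m ∷ʳ Y m
restrict-∷ʳ Y zero    = refl
restrict-∷ʳ Y (suc m) = cong (Y 0 ∷_) (restrict-∷ʳ (Y ∘ suc) m)

restrict-<ₗₑₓ : ∀ (X Y : Subsetω) {k m} → k < m → (∀ j → j < k → Y j ≡ X j) →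
                Y k Bool.< X k → restrict Y m <ₗₑₓ restrict X m
restrict-<ₗₑₓ X Y {zero}  {suc m} _         _     Yk<Xk = this Yk<Xk refl
restrict-<ₗₑₓ X Y {suc k} {suc m} (s≤s k<m) agree Yk<Xk =
  next (agree 0 (s≤s z≤n))
       (restrict-<ₗₑₓ (X ∘ suc) (Y ∘ suc) k<m (λ j j<k → agree (suc j) (s≤s j<k)) Yk<Xk)

-- Comparing keys lexicographically puts the subsets of m+1 that contain m first.
key : Subsetω → (m : ℕ) → Vec Bool (suc m)
key Y m = not (Y m) ∷ restrict Y m

fromKey : ∀ {m} → Vec Bool (suc m) → Subset (suc m)
fromKey (b ∷ v) = v ∷ʳ not b

fromKey-key : ∀ (Y : Subsetω) m → fromKey (key Y m) ≡ restrict Y (suc m)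
fromKey-key Y m = begin
  restrict Y m ∷ʳ not (not (Y m)) ≡⟨ cong (restrict Y m ∷ʳ_) (not-involutive (Y m)) ⟩
  restrict Y m ∷ʳ Y m             ≡⟨ restrict-∷ʳ Y m ⟨
  restrict Y (suc m)              ∎
  where open ≡-Reasoning

fromKey-injective : ∀ {m} (v w : Vec Bool (suc m)) → fromKey v ≡ fromKey w → v ≡ w
fromKey-injective (b ∷ v) (c ∷ w) eq with ∷ʳ-injective v w eq
... | refl , nb≡nc = cong (_∷ w) (not-injective nb≡nc)

select : (n : ℕ) → (Subset n → Bool) → Subset n
select zero    A = []
select (suc m) A = fromKey (least (A ∘ fromKey))

select-∈ : ∀ n (A : Subset n → Bool) (Y : Subsetω) → T (A (restrict Y n)) → T (A (select n A))
select-∈ zero    A Y Y∈A = Y∈A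
select-∈ (suc m) A Y Y∈A =
  least-satisfies (A ∘ fromKey) (key Y m) (subst (T ∘ A) (sym (fromKey-key Y m)) Y∈A)

select-minimal : ∀ m (A : Subset (suc m) → Bool) (X Y : Subsetω) →
                 restrict X (suc m) ≡ select (suc m) A → T (A (restrict Y (suc m))) →
                 ¬ (key Y m <ₗₑₓ key X m)
select-minimal m A X Y X≡select Y∈A Y<X =
  least-minimal (A ∘ fromKey) (key Y m) (subst (T ∘ A) (sym (fromKey-key Y m)) Y∈A)
    (subst (key Y m <ₗₑₓ_) keyX≡least Y<X)
  where
  keyX≡least : key X m ≡ least (A ∘ fromKey)
  keyX≡least = fromKey-injective _ _ (trans (fromKey-key X m) X≡select)

select-∋-max : ∀ m (A : Subset (suc m) → Bool) (X : Subsetω) →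
               restrict X (suc m) ≡ select (suc m) A →
               T (A (restrict (λ _ → true) (suc m))) → T (X m)
select-∋-max m A X X≡select ω∈A with X m in Xm≡false
... | true  = tt
... | false = select-minimal m A X (λ _ → true) X≡select ω∈A
                (this (subst (λ b → false Bool.< not b) (sym Xm≡false) Bool.f<t) refl)

delete : Subsetω → ℕ → Subsetω
delete X k j = if ⌊ j ≟ k ⌋ then false else X j

delete-≢ : ∀ X {k j} → j ≢ k → delete X k j ≡ X j
delete-≢ X {k} {j} j≢k with j ≟ k
... | yes j≡k = ⊥-elim (j≢k j≡k)
... | no _    = refl

delete-self : ∀ X k → delete X k k ≡ false
delete-self X k with k ≟ k
... | yes _   = refl
... | no k≢k  = ⊥-elim (k≢k refl)

select-∌-delete : ∀ m (A : Subset (suc m) → Bool) (X : Subsetω) {k} → k < m → T (X k) →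
                  restrict X (suc m) ≡ select (suc m) A → ¬ T (A (restrict (delete X k) (suc m)))
select-∌-delete m A X {k} k<m k∈X X≡select Y∈A =
  select-minimal m A X (delete X k) X≡select Y∈A
    (next (cong not (delete-≢ X (<⇒≢ k<m ∘ sym)))
          (restrict-<ₗₑₓ X (delete X k) k<m (λ j j<k → delete-≢ X (<⇒≢ j<k)) Yk<Xk))
  where
  Yk<Xk : delete X k k Bool.< X k
  Yk<Xk rewrite delete-self X k with X k
  ... | true = Bool.f<t

atLeast : ℕ → Subsetω
atLeast k n = ⌊ k ≤? n ⌋

module _ {U : Subsetω → Set} (uf : IsUltrafilter U) where
  open IsUltrafilter uf

  U-inhabited : ∀ {W} → U W → ¬ (∀ n → ¬ T (W n))
  U-inhabited {W} W∈U W-empty = noEmpty (upward W _ (λ n n∈W → W-empty n n∈W) W∈U)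

  U-meet₃ : ∀ {A B C} → U A → U B → U C →
            ¬ (∀ n → T (A n) → T (B n) → T (C n) → ⊥)
  U-meet₃ {A} {B} {C} A∈U B∈U C∈U disjoint =
    U-inhabited (inter A _ A∈U (inter B C B∈U C∈U)) λ n n∈ABC →
      let n∈A , n∈BC = Equivalence.to T-∧ n∈ABC
          n∈B , n∈C  = Equivalence.to (T-∧ {B n}) n∈BC
      in disjoint n n∈A n∈B n∈C

  atLeast-∈ : NonPrincipal U → ∀ k → U (atLeast k)
  atLeast-∈ np zero    = upward _ (atLeast 0) (λ n _ → fromWitness {a? = 0 ≤? n} z≤n) whole
  atLeast-∈ np (suc k) with ultra (singleton k)
  ... | inj₁ k∈U  = ⊥-elim (np k k∈U)
  ... | inj₂ ∁k∈U = upward _ _ above (inter _ _ (atLeast-∈ np k) ∁k∈U)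
    where
    above : ∀ n → T (atLeast k n ∧ not (singleton k n)) → T (atLeast (suc k) n)
    above n n∈ with n ≟ k | Equivalence.to (T-∧ {atLeast k n}) n∈
    ... | yes refl | _ , ()
    ... | no n≢k   | k≤n , _ = fromWitness (≤∧≢⇒< (toWitness k≤n) (n≢k ∘ sym))

  restrict-threadable : ∀ Z → Threadable U (restrict Z)
  restrict-threadable Z = Z , upward _ _ (λ n _ → fromWitness refl) whole

mainTheorem3 : (U : Subsetω → Set) → IsUltrafilter U → NonPrincipal U → ¬ DoddSound U
mainTheorem3 U uf np (𝒜 , sound) =
  U-meet₃ uf X-threads (𝒜-∋ (λ _ → true)) (atLeast-∈ uf np 1) λ
    { zero _ _ ()
    ; (suc m) X≡ ω∈ _ →
      U-meet₃ uf X-threads (𝒜-∋ (delete X m)) (atLeast-∈ uf np (suc (suc m))) λ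
        { zero _ _ ()
        ; (suc n) X≡′ Y∈ 2+m≤1+n →
            select-∌-delete n (𝒜 (suc n)) X (≤-pred (toWitness 2+m≤1+n))
              (select-∋-max m (𝒜 (suc m)) X (toWitness X≡) ω∈) (toWitness X≡′) Y∈ } }
  where
  𝒜-∋ : ∀ Z → U (λ n → 𝒜 n (restrict Z n))
  𝒜-∋ Z = Equivalence.to (sound (restrict Z)) (restrict-threadable uf Z)

  selection-threadable : Threadable U (λ n → select n (𝒜 n))
  selection-threadable = Equivalence.from (sound _)
    (upward _ _ (λ n → select-∈ n (𝒜 n) (λ _ → true)) (𝒜-∋ (λ _ → true)))
    where open IsUltrafilter uf

  X : Subsetω
  X = proj₁ selection-threadable

  X-threads : U (λ n → eqSub (restrict X n) (select n (𝒜 n)))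
  X-threads = proj₂ selection-threadable
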